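{- For every $n$, $d_{\mathcal{K}}(n)\ge \frac{1}{2^{\lfloor n/2\rfloor}}$, i.e. there is a family of at least $2^{\binom n2-\lfloor n/2\rfloor}$ graphs on $[n]$ no two distinct members of which have a symmetric difference that is a clique.
   Context: For a family $\mathcal{H}$ of graphs on the vertex set $[n]=\{1,\dots,n\}$ closed under isomorphism, a family $\mathcal{F}$ of graphs on $[n]$ is an $\mathcal{H}$-code if no two distinct members of $\mathcal{F}$ have symmetric difference (the graph on $[n]$ whose edges are those in exactly one of the two graphs) belonging to $\mathcal{H}$. $D_{\mathcal{H}}(n)$ is the maximum cardinality of an $\mathcal{H}$-code and $d_{\mathcal{H}}(n)=D_{\mathcal{H}}(n)/2^{\binom n2}$. $\mathcal{K}$ denotes the family of all cliques, i.e. graphs on $[n]$ whose edge set is the set of all pairs within some subset $U\subseteq[n]$. -}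

module Defs where

open import Data.Bool using (Bool; true; false; _xor_; _∧_; not)
open import Data.Fin using (Fin)
open import Data.Fin.Subset using (Subset)
open import Data.Vec using (lookup)
open import Data.List using (List)
open import Data.List.Relation.Unary.All using (All)
open import Data.List.Relation.Unary.AllPairs using (AllPairs)
open import Data.Product using (_×_; ∃)
open import Relation.Binary.PropositionalEquality using (_≡_)
open import Relation.Nullary using (¬_; does)
open import Data.Fin using (_≟_)

Adj : (n : _) → Set
Adj n = Fin n → Fin n → Bool

IsGraph : ∀ {n} → Adj n → Set
IsGraph {n} G = (∀ (i j : Fin n) → G i j ≡ G j i) × (∀ (i : Fin n) → G i i ≡ false)

SameGraph : ∀ {n} → Adj n → Adj n → Set
SameGraph {n} G H = ∀ (i j : Fin n) → G i j ≡ H i j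

symDiff : ∀ {n} → Adj n → Adj n → Adj n
symDiff G H i j = G i j xor H i j

cliqueOn : ∀ {n} → Subset n → Adj n
cliqueOn U i j = not (does (i ≟ j)) ∧ (lookup U i ∧ lookup U j)

IsClique : ∀ {n} → Adj n → Set
IsClique {n} G = ∃ λ (U : Subset n) → SameGraph G (cliqueOn U)

-- A 𝒦-code: a family of graphs on [n] (listed without repetition) such that
-- no two distinct members have a clique as symmetric difference.
IsCliqueCode : ∀ {n} → List (Adj n) → Set
IsCliqueCode F =
  All IsGraph F ×
  AllPairs (λ G H → ¬ SameGraph G H × ¬ IsClique (symDiff G H)) F

-- Pair up the vertices as {0,1}, {2,3}, … and call a graph a code word if, for
-- every k, the subgraph it induces on the tail {2k, …, n−1} (when this has at
-- least two vertices) has an even number of edges.  These are ⌊n/2⌋ parity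
-- conditions, each of which fixes the edge {2k, 2k+1} once the edges from 2k
-- and 2k+1 to later vertices are chosen freely; so there are 2^(C(n,2) − ⌊n/2⌋)
-- code words.  Parity is additive, so the symmetric difference of two code
-- words is a code word.  A clique on U with |U| ≥ 2 is not one: the shortest
-- tail containing two vertices of U contains two or three of them, and so
-- spans one or three edges.
module Submission where

open import Defs
open import Data.Nat using (ℕ; _≤_; _^_; _∸_; _/_)
open import Data.Nat.Combinatorics using (_C_)
open import Data.List using (List; length)
open import Data.Product using (Σ; _×_)

open import Algebra.Bundles using (CommutativeRing)
open import Data.Bool using (Bool; true; false; _xor_; _∧_; not)
open import Data.Bool.Properties using (xor-∧-commutativeRing; ∧-zeroʳ; not-involutive)
open import Data.Fin using (zero; suc)
open import Data.Fin.Subset using (Subset; ∣_∣)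
open import Data.Fin.Subset.Properties using (∣p∣≤∣x∷p∣)
open import Data.List using ([]; _∷_; map; _++_; cartesianProductWith)
open import Data.List.Properties using (length-++; length-map)
import Data.List.Relation.Unary.All as All
import Data.List.Relation.Unary.All.Properties as All
import Data.List.Relation.Unary.AllPairs as AllPairs
import Data.List.Relation.Unary.AllPairs.Properties as AllPairs
open import Data.List.Relation.Unary.Unique.Propositional using (Unique)
open import Data.List.Relation.Unary.Unique.Propositional.Properties using (cartesianProductWith⁺)
open import Data.Nat using (zero; suc; _+_; _*_; z≤n; s≤s)
open import Data.Nat.Combinatorics using (nCk+nC[k+1]≡[n+1]C[k+1]; nC1≡n)
open import Data.Nat.DivMod using (m/n≡1+[m∸n]/n)
open import Data.Nat.Properties using (≤-refl; ≤-trans; ≤-reflexive; ≤-pred; n≤1+n; m+n∸n≡m)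
open import Data.Nat.Solver using (module +-*-Solver)
open import Data.Product using (_,_)
open import Data.Unit using (⊤; tt)
open import Data.Vec using (Vec; []; _∷_; lookup; take; drop)
import Data.Vec as Vec
open import Data.Vec.Properties using (take++drop≡id; tabulate∘lookup; tabulate-cong; ∷-injective)
open import Function using (_∘_)
open import Relation.Binary.PropositionalEquality
  using (_≡_; _≢_; _≗_; refl; sym; trans; cong; cong₂; module ≡-Reasoning)
open import Relation.Nullary using (¬_)

-- Sums are taken in the Boolean ring (xor, ∧): sum f is the parity of the
-- number of j with f j ≡ true.
open CommutativeRing xor-∧-commutativeRing using (semiring; +-commutativeSemigroup)
open import Algebra.Properties.Semiring.Sum semiring using (sum; sum-cong-≗; sum-replicate-zero; ∑-distrib-+)
open import Algebra.Properties.CommutativeSemigroup +-commutativeSemigroup using (interchange)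

private variable n : ℕ

isOdd : ℕ → Bool
isOdd zero    = false
isOdd (suc k) = not (isOdd k)

-- The parity of m C 2, computed from (1 + m) C 2 = m + m C 2.
pairParity : ℕ → Bool
pairParity zero    = false
pairParity (suc m) = isOdd m xor pairParity m

pairParity-even : ∀ m → m ≤ 3 → pairParity m ≡ false → m ≤ 1
pairParity-even 0 _ _ = z≤n
pairParity-even 1 _ _ = s≤s z≤n
pairParity-even 2 _ ()
pairParity-even 3 _ ()
pairParity-even (suc (suc (suc (suc _)))) (s≤s (s≤s (s≤s ()))) _

xor≡false⇒≡ : ∀ {a b} → a xor b ≡ false → a ≡ b
xor≡false⇒≡ {false} {false} _ = refl
xor≡false⇒≡ {true}  {true}  _ = refl
xor≡false⇒≡ {false} {true}  ()
xor≡false⇒≡ {true}  {false} ()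

xor-cancel : ∀ a b c → ((a xor b) xor a) xor (b xor c) ≡ c
xor-cancel false false c = refl
xor-cancel false true  c = not-involutive c
xor-cancel true  false c = refl
xor-cancel true  true  c = not-involutive c

dropFirst : Adj (suc n) → Adj n
dropFirst G i j = G (suc i) (suc j)

edgeParity : Adj n → Bool
edgeParity {zero}  G = false
edgeParity {suc n} G = sum (λ j → G zero (suc j)) xor edgeParity (dropFirst G)

EvenTails : Adj n → Set
EvenTails {zero}        G = ⊤
EvenTails {suc zero}    G = ⊤
EvenTails {suc (suc n)} G = edgeParity G ≡ false × EvenTails (dropFirst (dropFirst G))

EvenTails⇒even : {G : Adj n} → EvenTails G → edgeParity G ≡ false
EvenTails⇒even {zero}        _          = refl
EvenTails⇒even {suc zero}    _          = refl
EvenTails⇒even {suc (suc n)} (even , _) = even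

edgeParity-cong : {G H : Adj n} → SameGraph G H → edgeParity G ≡ edgeParity H
edgeParity-cong {zero}  G≈H = refl
edgeParity-cong {suc n} G≈H =
  cong₂ _xor_ (sum-cong-≗ (λ j → G≈H zero (suc j))) (edgeParity-cong (λ i j → G≈H (suc i) (suc j)))

EvenTails-cong : {G H : Adj n} → SameGraph G H → EvenTails G → EvenTails H
EvenTails-cong {zero}        _   _              = tt
EvenTails-cong {suc zero}    _   _              = tt
EvenTails-cong {suc (suc n)} G≈H (even , tails) =
  trans (sym (edgeParity-cong G≈H)) even ,
  EvenTails-cong (λ i j → G≈H (suc (suc i)) (suc (suc j))) tails

edgeParity-symDiff : (G H : Adj n) → edgeParity (symDiff G H) ≡ edgeParity G xor edgeParity H
edgeParity-symDiff {zero}  G H = refl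
edgeParity-symDiff {suc n} G H =
  trans (cong₂ _xor_ (∑-distrib-+ (λ j → G zero (suc j)) (λ j → H zero (suc j)))
                     (edgeParity-symDiff (dropFirst G) (dropFirst H)))
        (interchange (sum (λ j → G zero (suc j))) (sum (λ j → H zero (suc j)))
                     (edgeParity (dropFirst G)) (edgeParity (dropFirst H)))

EvenTails-symDiff : {G H : Adj n} → EvenTails G → EvenTails H → EvenTails (symDiff G H)
EvenTails-symDiff {zero}        _ _ = tt
EvenTails-symDiff {suc zero}    _ _ = tt
EvenTails-symDiff {suc (suc n)} {G} {H} (evenG , tailsG) (evenH , tailsH) =
  trans (edgeParity-symDiff G H) (cong₂ _xor_ evenG evenH) , EvenTails-symDiff tailsG tailsH

∣x∷p∣≤1+∣p∣ : ∀ x (p : Subset n) → ∣ x ∷ p ∣ ≤ suc ∣ p ∣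
∣x∷p∣≤1+∣p∣ true  p = ≤-refl
∣x∷p∣≤1+∣p∣ false p = n≤1+n ∣ p ∣

∣p∣≤0⇒lookup≡false : (p : Subset n) → ∣ p ∣ ≤ 0 → ∀ j → lookup p j ≡ false
∣p∣≤0⇒lookup≡false (true  ∷ p) ()
∣p∣≤0⇒lookup≡false (false ∷ p) _     zero    = refl
∣p∣≤0⇒lookup≡false (false ∷ p) ∣p∣≤0 (suc j) = ∣p∣≤0⇒lookup≡false p ∣p∣≤0 j

sum-lookup : (p : Subset n) → sum (lookup p) ≡ isOdd ∣ p ∣
sum-lookup []          = refl
sum-lookup (true  ∷ p) = cong not (sum-lookup p)
sum-lookup (false ∷ p) = sum-lookup p

edgeParity-cliqueOn : (U : Subset n) → edgeParity (cliqueOn U) ≡ pairParity ∣ U ∣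
edgeParity-cliqueOn         []          = refl
edgeParity-cliqueOn         (true  ∷ U) = cong₂ _xor_ (sum-lookup U) (edgeParity-cliqueOn U)
edgeParity-cliqueOn {suc n} (false ∷ U) = cong₂ _xor_ (sum-replicate-zero n) (edgeParity-cliqueOn U)

EvenTails-cliqueOn⇒∣U∣≤1 : (U : Subset n) → EvenTails (cliqueOn U) → ∣ U ∣ ≤ 1
EvenTails-cliqueOn⇒∣U∣≤1 []          _              = z≤n
EvenTails-cliqueOn⇒∣U∣≤1 (a ∷ [])    _              = ∣x∷p∣≤1+∣p∣ a []
EvenTails-cliqueOn⇒∣U∣≤1 (a ∷ b ∷ U) (even , tails) =
  pairParity-even _ ∣U∣≤3 (trans (sym (edgeParity-cliqueOn (a ∷ b ∷ U))) even)
  where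
  ∣U∣≤3 : ∣ a ∷ b ∷ U ∣ ≤ 3
  ∣U∣≤3 = ≤-trans (∣x∷p∣≤1+∣p∣ a (b ∷ U))
            (s≤s (≤-trans (∣x∷p∣≤1+∣p∣ b U)
                    (s≤s (EvenTails-cliqueOn⇒∣U∣≤1 U tails))))

cliqueOn-edgeless : (U : Subset n) → ∣ U ∣ ≤ 1 → ∀ i j → cliqueOn U i j ≡ false
cliqueOn-edgeless (a     ∷ U) _     zero    zero    = refl
cliqueOn-edgeless (true  ∷ U) ∣U∣≤1 zero    (suc j) = ∣p∣≤0⇒lookup≡false U (≤-pred ∣U∣≤1) j
cliqueOn-edgeless (false ∷ U) _     zero    (suc j) = refl
cliqueOn-edgeless (true  ∷ U) ∣U∣≤1 (suc i) zero    =
  cong (_∧ true) (∣p∣≤0⇒lookup≡false U (≤-pred ∣U∣≤1) i)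
cliqueOn-edgeless (false ∷ U) _     (suc i) zero    = ∧-zeroʳ (lookup U i)
cliqueOn-edgeless (a     ∷ U) ∣U∣≤1 (suc i) (suc j) =
  cliqueOn-edgeless U (≤-trans (∣p∣≤∣x∷p∣ a U) ∣U∣≤1) i j

EvenTails∧IsClique⇒edgeless : {D : Adj n} → EvenTails D → IsClique D → ∀ i j → D i j ≡ false
EvenTails∧IsClique⇒edgeless even (U , D≈K) i j =
  trans (D≈K i j) (cliqueOn-edgeless U (EvenTails-cliqueOn⇒∣U∣≤1 U (EvenTails-cong D≈K even)) i j)

-- The new vertices 0 and 1 are joined exactly when this keeps the edge parity of G.
extend : Adj n → Vec Bool n → Vec Bool n → Adj (suc (suc n))
extend G r₀ r₁ zero          zero          = false
extend G r₀ r₁ zero          (suc zero)    = sum (lookup r₀) xor sum (lookup r₁)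
extend G r₀ r₁ zero          (suc (suc j)) = lookup r₀ j
extend G r₀ r₁ (suc zero)    zero          = sum (lookup r₀) xor sum (lookup r₁)
extend G r₀ r₁ (suc zero)    (suc zero)    = false
extend G r₀ r₁ (suc zero)    (suc (suc j)) = lookup r₁ j
extend G r₀ r₁ (suc (suc i)) zero          = lookup r₀ i
extend G r₀ r₁ (suc (suc i)) (suc zero)    = lookup r₁ i
extend G r₀ r₁ (suc (suc i)) (suc (suc j)) = G i j

extend-isGraph : {G : Adj n} (r₀ r₁ : Vec Bool n) → IsGraph G → IsGraph (extend G r₀ r₁)
extend-isGraph {G = G} r₀ r₁ (symmetric , irreflexive) = symmetric′ , irreflexive′
  where
  symmetric′ : ∀ i j → extend G r₀ r₁ i j ≡ extend G r₀ r₁ j i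
  symmetric′ zero          zero          = refl
  symmetric′ zero          (suc zero)    = refl
  symmetric′ zero          (suc (suc j)) = refl
  symmetric′ (suc zero)    zero          = refl
  symmetric′ (suc zero)    (suc zero)    = refl
  symmetric′ (suc zero)    (suc (suc j)) = refl
  symmetric′ (suc (suc i)) zero          = refl
  symmetric′ (suc (suc i)) (suc zero)    = refl
  symmetric′ (suc (suc i)) (suc (suc j)) = symmetric i j

  irreflexive′ : ∀ i → extend G r₀ r₁ i i ≡ false
  irreflexive′ zero          = refl
  irreflexive′ (suc zero)    = refl
  irreflexive′ (suc (suc i)) = irreflexive i

edgeParity-extend : (G : Adj n) (r₀ r₁ : Vec Bool n) → edgeParity (extend G r₀ r₁) ≡ edgeParity G
edgeParity-extend G r₀ r₁ = xor-cancel (sum (lookup r₀)) (sum (lookup r₁)) (edgeParity G)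

freeBits : ℕ → ℕ
freeBits zero          = 0
freeBits (suc zero)    = 0
freeBits (suc (suc n)) = freeBits n + (n + n)

encode : ∀ n → Vec Bool (freeBits n) → Adj n
encode zero          _ = λ _ _ → false
encode (suc zero)    _ = λ _ _ → false
encode (suc (suc n)) v = extend (encode n (take (freeBits n) v)) (take n rows) (drop n rows)
  where rows = drop (freeBits n) v

encode-isGraph : ∀ n (v : Vec Bool (freeBits n)) → IsGraph (encode n v)
encode-isGraph zero          _ = (λ _ _ → refl) , (λ _ → refl)
encode-isGraph (suc zero)    _ = (λ _ _ → refl) , (λ _ → refl)
encode-isGraph (suc (suc n)) v = extend-isGraph _ _ (encode-isGraph n _)

encode-evenTails : ∀ n (v : Vec Bool (freeBits n)) → EvenTails (encode n v)
encode-evenTails zero          _ = tt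
encode-evenTails (suc zero)    _ = tt
encode-evenTails (suc (suc n)) v =
  trans (edgeParity-extend (encode n old) (take n rows) (drop n rows))
        (EvenTails⇒even (encode-evenTails n old)) ,
  encode-evenTails n old
  where
  old  = take (freeBits n) v
  rows = drop (freeBits n) v

lookup-ext : ∀ {A : Set} {v w : Vec A n} → lookup v ≗ lookup w → v ≡ w
lookup-ext {v = v} {w} v≗w =
  trans (sym (tabulate∘lookup v)) (trans (tabulate-cong v≗w) (tabulate∘lookup w))

take-drop-injective : ∀ {A : Set} m {k} (v w : Vec A (m + k)) →
                      take m v ≡ take m w → drop m v ≡ drop m w → v ≡ w
take-drop-injective m v w take≡ drop≡ =
  trans (sym (take++drop≡id m v)) (trans (cong₂ Vec._++_ take≡ drop≡) (take++drop≡id m w))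

encode-injective : ∀ n (v w : Vec Bool (freeBits n)) → SameGraph (encode n v) (encode n w) → v ≡ w
encode-injective zero          [] [] _    = refl
encode-injective (suc zero)    [] [] _    = refl
encode-injective (suc (suc n)) v  w  same =
  take-drop-injective (freeBits n) v w
    (encode-injective n _ _ (λ i j → same (suc (suc i)) (suc (suc j))))
    (take-drop-injective n _ _
      (lookup-ext (λ j → same zero (suc (suc j))))
      (lookup-ext (λ j → same (suc zero) (suc (suc j)))))

encode-separated : ∀ n {v w : Vec Bool (freeBits n)} → v ≢ w →
                   ¬ SameGraph (encode n v) (encode n w) × ¬ IsClique (symDiff (encode n v) (encode n w))
encode-separated n {v} {w} v≢w =
  v≢w ∘ encode-injective n v w , v≢w ∘ encode-injective n v w ∘ cliqueDiff⇒same
  where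
  cliqueDiff⇒same : IsClique (symDiff (encode n v) (encode n w)) → SameGraph (encode n v) (encode n w)
  cliqueDiff⇒same K i j = xor≡false⇒≡
    (EvenTails∧IsClique⇒edgeless (EvenTails-symDiff (encode-evenTails n v) (encode-evenTails n w)) K i j)

length-cartesianProductWith : ∀ {A B C : Set} (f : A → B → C) (xs : List A) (ys : List B) →
                              length (cartesianProductWith f xs ys) ≡ length xs * length ys
length-cartesianProductWith f []       ys = refl
length-cartesianProductWith f (x ∷ xs) ys = begin
  length (map (f x) ys ++ cartesianProductWith f xs ys)          ≡⟨ length-++ (map (f x) ys) ⟩
  length (map (f x) ys) + length (cartesianProductWith f xs ys)  ≡⟨ cong₂ _+_ (length-map (f x) ys)
                                                                       (length-cartesianProductWith f xs ys) ⟩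
  length ys + length xs * length ys                              ∎
  where open ≡-Reasoning

allVecs : ∀ N → List (Vec Bool N)
allVecs zero    = [] ∷ []
allVecs (suc N) = cartesianProductWith _∷_ (true ∷ false ∷ []) (allVecs N)

length-allVecs : ∀ N → length (allVecs N) ≡ 2 ^ N
length-allVecs zero    = refl
length-allVecs (suc N) =
  trans (length-cartesianProductWith _∷_ (true ∷ false ∷ []) (allVecs N)) (cong (2 *_) (length-allVecs N))

allVecs-unique : ∀ N → Unique (allVecs N)
allVecs-unique zero    = All.[] AllPairs.∷ AllPairs.[]
allVecs-unique (suc N) = cartesianProductWith⁺ _∷_ ∷-injective trueFalse-unique (allVecs-unique N)
  where
  trueFalse-unique : Unique (true ∷ false ∷ [])
  trueFalse-unique = ((λ ()) All.∷ All.[]) AllPairs.∷ (All.[] AllPairs.∷ AllPairs.[])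

[1+n]C2≡n+nC2 : ∀ n → suc n C 2 ≡ n + n C 2
[1+n]C2≡n+nC2 n = trans (sym (nCk+nC[k+1]≡[n+1]C[k+1] n 1)) (cong (_+ n C 2) (nC1≡n n))

freeBits+n/2≡nC2 : ∀ n → freeBits n + n / 2 ≡ n C 2
freeBits+n/2≡nC2 zero          = refl
freeBits+n/2≡nC2 (suc zero)    = refl
freeBits+n/2≡nC2 (suc (suc n)) = begin
  freeBits n + (n + n) + suc (suc n) / 2
    ≡⟨ cong (freeBits n + (n + n) +_) (m/n≡1+[m∸n]/n {suc (suc n)} {2} (s≤s (s≤s z≤n))) ⟩
  freeBits n + (n + n) + suc (n / 2)
    ≡⟨ solve 3 (λ b m h → b :+ (m :+ m) :+ (con 1 :+ h) := (con 1 :+ m) :+ (m :+ (b :+ h)))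
             refl (freeBits n) n (n / 2) ⟩
  suc n + (n + (freeBits n + n / 2))
    ≡⟨ cong (λ t → suc n + (n + t)) (freeBits+n/2≡nC2 n) ⟩
  suc n + (n + n C 2)
    ≡⟨ cong (suc n +_) (sym ([1+n]C2≡n+nC2 n)) ⟩
  suc n + suc n C 2
    ≡⟨ sym ([1+n]C2≡n+nC2 (suc n)) ⟩
  suc (suc n) C 2
    ∎
  where open ≡-Reasoning
        open +-*-Solver

nC2∸n/2≡freeBits : ∀ n → n C 2 ∸ n / 2 ≡ freeBits n
nC2∸n/2≡freeBits n = trans (cong (_∸ n / 2) (sym (freeBits+n/2≡nC2 n))) (m+n∸n≡m (freeBits n) (n / 2))

proposition1p4 : (n : ℕ) →
    Σ (List (Adj n)) λ F → IsCliqueCode F × 2 ^ (n C 2 ∸ n / 2) ≤ length F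
proposition1p4 n =
  map (encode n) vs ,
  (All.map⁺ (All.universal (encode-isGraph n) vs) ,
   AllPairs.map⁺ (AllPairs.map (encode-separated n) (allVecs-unique (freeBits n)))) ,
  ≤-reflexive (begin
    2 ^ (n C 2 ∸ n / 2)      ≡⟨ cong (2 ^_) (nC2∸n/2≡freeBits n) ⟩
    2 ^ freeBits n           ≡⟨ sym (length-allVecs (freeBits n)) ⟩
    length vs                ≡⟨ sym (length-map (encode n) vs) ⟩
    length (map (encode n) vs) ∎)
  where
  vs = allVecs (freeBits n)
  open ≡-Reasoning
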